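{- Let $n\geq3$. Suppose that for every finite down-set $D\subseteq X_{n-1}$, the initial segment $I$ of the balanced order on $X_{n-1}$ with $|I|=|D|$ satisfies $|S(I)|\geq|S(D)|$. Then for every finite down-set $A\subseteq X_n$ and every $i\in\{1,\dots,n\}$, the set $A'=\mathcal{C}^{\mathrm{bal}}_i(A)$ satisfies: (i) $A'$ is a down-set; (ii) $|S(A')|\geq|S(A)|$; (iii) if moreover initial segments of the balanced order on $X_{n-1}$ minimise $\mathrm{gap}$ among subsets of $X_{n-1}$ of the same size, then $\mathrm{gap}(A')\leq\mathrm{gap}(A)$.
   Context: $X_n=\{x\in\mathbb{Z}_{\ge0}^n: x_k=0\text{ for some } k\}$. A set $A\subseteq X_n$ is a down-set if whenever $x\in\mathbb{Z}_{\ge0}^n$, $y\in A$ and $x_k\le y_k$ for all $k$, then $x\in A$. $\pi_k$ deletes the $k$-th coordinate and $\mathrm{gap}(A)=\sum_k|\pi_k(A)|-|A|$. Balanced order on $X_n$: for distinct $x,y$ let $T=\{k:x_k\ne y_k\}$, $M_x=\max_{k\in T}x_k$, $M_y=\max_{k\in T}y_k$; $x<y$ iff $M_x<M_y$, or $M_x=M_y$ and $\max\{k\in T:x_k=M_x\}<\max\{k\in T:y_k=M_y\}$ (a total order); initial segments are sets of the smallest elements. For $A\subseteq X_n$ let $S(A)=\{x\in\mathbb{Z}_{>0}^n:$ for every $k$, the vector obtained from $x$ by setting its $k$-th coordinate to $0$ lies in $A\}$. For finite $A\subseteq X_n$ and $a\in\mathbb{Z}_{\ge0}$, let $L^i_a(A)=\{(x_1,\dots,x_{i-1},x_{i+1},\dots,x_n)\in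 X_{n-1}:(x_1,\dots,x_{i-1},a,x_{i+1},\dots,x_n)\in A\}$ and $K^i(A)=\{(x_1,\dots,x_{i-1},x_{i+1},\dots,x_n)\in\mathbb{Z}_{>0}^{n-1}:(x_1,\dots,x_{i-1},0,x_{i+1},\dots,x_n)\in A\}$. Order $\mathbb{Z}_{>0}^{n-1}$ by $u\prec v$ iff inserting $0$ at position $i$ into $u$ and into $v$ gives vectors with the first smaller than the second in the balanced order on $X_n$. The balanced-$i$-compression $A'=\mathcal{C}^{\mathrm{bal}}_i(A)\subseteq X_n$ is the set determined by: $L^i_a(A')$ is the initial segment of the balanced order on $X_{n-1}$ of size $|L^i_a(A)|$ for each $a$, and $K^i(A')$ is the set of the first $|K^i(A)|$ elements of $(\mathbb{Z}_{>0}^{n-1},\prec)$. -}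

module Defs where

open import Data.Nat using (ℕ; zero; suc; _+_; _≤_; _<_; _⊔_)
open import Data.Nat.Properties using (_≟_)
open import Data.Fin using (Fin; toℕ)
open import Data.Vec using (Vec; lookup; insertAt; removeAt; _[_]≔_; tabulate)
import Data.Vec as V
open import Data.List using (List; length; map; foldr; allFin)
open import Data.List.Membership.Propositional using (_∈_)
open import Data.List.Relation.Unary.Unique.Propositional using (Unique)
open import Data.Product using (Σ; ∃; _×_; _,_)
open import Data.Sum using (_⊎_)
open import Data.Bool using (if_then_else_; _∧_; not)
open import Relation.Nullary using (¬_; does)
open import Relation.Binary.PropositionalEquality using (_≡_; _≢_)
open import Function.Bundles using (_⇔_)

Pt : ℕ → Set
Pt n = Vec ℕ n

Subset : ℕ → Set₁
Subset n = Pt n → Set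

X : (n : ℕ) → Subset n
X n x = ∃ λ (k : Fin n) → lookup x k ≡ 0

Pos : (n : ℕ) → Subset n
Pos n x = ∀ (k : Fin n) → 0 < lookup x k

_⊆_ : ∀ {n} → Subset n → Subset n → Set
A ⊆ B = ∀ x → A x → B x

Size : ∀ {n} → Subset n → ℕ → Set
Size {n} P k = Σ (List (Pt n)) λ l → Unique l × (∀ x → (x ∈ l) ⇔ P x) × length l ≡ k

Finite : ∀ {n} → Subset n → Set
Finite P = ∃ λ k → Size P k

SizeLe : ∀ {n} → Subset n → Subset n → Set
SizeLe P Q = ∀ s t → Size P s → Size Q t → s ≤ t

DownSet : (n : ℕ) → Subset n → Set
DownSet n A = (A ⊆ X n) × (∀ x y → A y → (∀ k → lookup x k ≤ lookup y k) → A x)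

S : (n : ℕ) → Subset n → Subset n
S n A x = Pos n x × (∀ (k : Fin n) → A (x [ k ]≔ 0))

maxList : List ℕ → ℕ
maxList = foldr _⊔_ 0

differs : ∀ {n} → Pt n → Pt n → Fin n → Data.Bool.Bool
differs x y k = not (does (lookup x k ≟ lookup y k))
  where import Data.Bool

-- M_x = max_{k ∈ T} x_k  (T nonempty whenever x ≠ y; all values are ≥ 0,
-- so using 0 for k ∉ T does not change the maximum)
Mx : ∀ {n} → Pt n → Pt n → ℕ
Mx {n} x y = maxList (map (λ k → if differs x y k then lookup x k else 0) (allFin n))

-- max{k ∈ T : x_k = M_x}, as the natural number toℕ k (this set is nonempty
-- whenever x ≠ y, so using 0 for other k does not change the maximum)
Jx : ∀ {n} → Pt n → Pt n → ℕ
Jx {n} x y = maxList (map (λ k → if differs x y k ∧ does (lookup x k ≟ Mx x y)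
                                   then toℕ k else 0) (allFin n))

_<b_ : ∀ {n} → Pt n → Pt n → Set
x <b y = x ≢ y × (Mx x y < Mx y x ⊎ (Mx x y ≡ Mx y x × Jx x y < Jx y x))

BalInit : (n : ℕ) → Subset n → ℕ → Set
BalInit n I k = (I ⊆ X n) × Size I k × (∀ x y → X n x → I y → x <b y → I x)

PosInit : (n : ℕ) → Fin (suc n) → Subset n → ℕ → Set
PosInit n i I k = (I ⊆ Pos n) × Size I k
  × (∀ x y → Pos n x → I y → insertAt x i 0 <b insertAt y i 0 → I x)

L : (n : ℕ) → Fin (suc n) → ℕ → Subset (suc n) → Subset n
L n i a A y = X n y × A (insertAt y i a)

K : (n : ℕ) → Fin (suc n) → Subset (suc n) → Subset n
K n i A y = Pos n y × A (insertAt y i 0)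

-- A' = C^bal_i(A)  (A' is uniquely determined by these conditions)
IsBalCompression : (n : ℕ) → Fin (suc n) → Subset (suc n) → Subset (suc n) → Set
IsBalCompression n i A A' =
  (A' ⊆ X (suc n))
  × (∀ a k → Size (L n i a A) k → BalInit n (L n i a A') k)
  × (∀ k → Size (K n i A) k → PosInit n i (K n i A') k)

proj : (n : ℕ) → Fin (suc n) → Subset (suc n) → Subset n
proj n k A y = ∃ λ x → A x × removeAt x k ≡ y

-- gap(A) ≤ gap(B), where gap(A) = Σ_k |π_k(A)| - |A| (for finite A, B);
-- the integer inequality is written additively in ℕ.
GapLe : (n : ℕ) → Subset (suc n) → Subset (suc n) → Set
GapLe n A B = ∀ (p q : Fin (suc n) → ℕ) (a b : ℕ)
  → (∀ k → Size (proj n k A) (p k)) → (∀ k → Size (proj n k B) (q k))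
  → Size A a → Size B b
  → V.sum (tabulate p) + b ≤ V.sum (tabulate q) + a

SHyp : (n : ℕ) → Set₁
SHyp n = ∀ (D : Subset n) → DownSet n D → ∀ k → Size D k
  → ∀ (I : Subset n) → BalInit n I k → SizeLe (S n D) (S n I)

GapHyp : (n : ℕ) → Set₁
GapHyp n = ∀ (B : Subset (suc n)) → B ⊆ X (suc n) → ∀ k → Size B k
  → ∀ (I : Subset (suc n)) → BalInit (suc n) I k → GapLe n I B

module Submission where

-- Slice A along coordinate i: A' has, at every height a, the initial segment L_a(A') of the
-- balanced order of the same size as L_a(A), and its "floor" K(A') is an initial segment of ≺.
-- Since A is a down-set the sizes |L_a(A)| decrease in a, so the L_a(A') are nested; this and
-- K(A') ⊆ S(L_0(A')) make A' a down-set.  The points of S(A) at height a > 0 are those of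
-- K(A) ∩ S(L_a(A)); when both sets are initial segments of ≺ this intersection is the smaller of
-- the two, and the hypothesis |S(L_a(A))| ≤ |S(L_a(A'))| gives |S(A)| ≤ |S(A')| height by height.
-- Finally Σ_k |π_k(D)| counts the zero coordinates of the points of a down-set D, and comparing
-- these counts height by height reduces (iii) to the gap hypothesis for each slice L_a.

open import Defs
import Data.Nat.Properties as ℕ
open import Algebra.Properties.CommutativeSemigroup ℕ.+-commutativeSemigroup using (interchange; x∙yz≈y∙xz)
open import Data.Bool using (if_then_else_; _∧_)
open import Data.Empty using (⊥-elim)
open import Data.Fin using (Fin; toℕ; punchIn; punchOut)
  renaming (zero to fzero; suc to fsuc; _<_ to _<ᶠ_; _≤_ to _≤ᶠ_)
import Data.Fin.Properties as Fin
open import Data.List using (List; []; _∷_; map; filter; length; deduplicate; allFin; cartesianProductWith)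
import Data.List.Membership.DecPropositional as DecMembership
open import Data.List.Membership.Propositional using (_∈_)
open import Data.List.Membership.Propositional.Properties
  using (∈-map⁺; ∈-map⁻; ∈-filter⁺; ∈-filter⁻; ∈-deduplicate⁺; ∈-deduplicate⁻; ∈-allFin;
         ∈-cartesianProductWith⁺)
open import Data.List.Membership.Propositional.Properties.WithK using (unique∧set⇒bag)
open import Data.List.Properties using (map-∘)
open import Data.List.Relation.Binary.BagAndSetEquality using (∼bag⇒↭)
open import Data.List.Relation.Binary.Permutation.Propositional.Properties using (map⁺)
import Data.List.Relation.Unary.All as All
import Data.List.Relation.Unary.All.Properties as All
open import Data.List.Relation.Unary.AllPairs using ([]; _∷_)
open import Data.List.Relation.Unary.Any using (here; there)
open import Data.List.Relation.Unary.Unique.Propositional using (Unique)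
open import Data.List.Relation.Unary.Unique.Propositional.Properties using (filter⁺)
open import Data.List.Relation.Unary.Unique.DecPropositional.Properties using (deduplicate-!)
open import Data.Nat using (ℕ; zero; suc; _+_; _*_; _≤_; _<_; _≟_; _≤?_; z≤n; s≤s)
open import Data.Nat.ListAction using (sum)
open import Data.Nat.ListAction.Properties using (sum-↭)
open import Data.Product using (Σ; ∃; _×_; _,_; proj₁; proj₂)
open import Data.Product.Relation.Binary.Lex.Strict using (×-Lex)
open import Data.Sum using (_⊎_; inj₁; inj₂)
open import Data.Vec using ([]; _∷_; lookup; insertAt; removeAt; _[_]≔_; tabulate)
import Data.Vec as Vec
open import Data.Vec.Properties
  using (≡-dec; lookup∘update; lookup∘update′; insertAt-lookup; insertAt-punchIn; removeAt-insertAt; insertAt-removeAt;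
         tabulate∘lookup; tabulate-cong)
open import Function.Base using (_∘_)
open import Function.Bundles using (_⇔_; mk⇔; Equivalence)
open import Relation.Binary.Definitions using (tri<; tri≈; tri>)
open import Relation.Binary.PropositionalEquality
open import Relation.Nullary using (¬_; Dec; yes; no; does; ¬?)
open import Relation.Nullary.Decidable using (dec-true; dec-false; decidable-stable; _×-dec_)
open import Relation.Unary using (_∩_; ∁; Decidable)
open import Relation.Unary.Properties using (∁?)

-- Finite sums

open Equivalence using (to; from)

_≟ᵥ_ : ∀ {n} (x y : Pt n) → Dec (x ≡ y)
_≟ᵥ_ = ≡-dec _≟_

module _ {n : ℕ} where

  SumOver : Subset n → (Pt n → ℕ) → ℕ → Set
  SumOver P f v = Σ (List (Pt n)) λ l → Unique l × (∀ x → x ∈ l ⇔ P x) × sum (map f l) ≡ v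

  Level : (Pt n → ℕ) → Subset n → ℕ → Subset n
  Level c P a x = P x × c x ≡ a

  length≡sum-map-1 : (l : List (Pt n)) → length l ≡ sum (map (λ _ → 1) l)
  length≡sum-map-1 [] = refl
  length≡sum-map-1 (x ∷ l) = cong suc (length≡sum-map-1 l)

  size⇒sumOver : ∀ {P : Subset n} {s} → Size P s → SumOver P (λ _ → 1) s
  size⇒sumOver (l , u , mem , e) = l , u , mem , trans (sym (length≡sum-map-1 l)) e

  sumOver⇒size : ∀ {P : Subset n} {s} → SumOver P (λ _ → 1) s → Size P s
  sumOver⇒size (l , u , mem , e) = l , u , mem , trans (length≡sum-map-1 l) e

  sumOver-unique : ∀ {P : Subset n} {f v w} → SumOver P f v → SumOver P f w → v ≡ w
  sumOver-unique {f = f} (l , u , mem , refl) (l' , u' , mem' , refl) =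
    sum-↭ (map⁺ f (∼bag⇒↭ (unique∧set⇒bag u u' λ {x} →
      mk⇔ (from (mem' x) ∘ to (mem x)) (from (mem x) ∘ to (mem' x)))))

  size-unique : ∀ {P : Subset n} {s t} → Size P s → Size P t → s ≡ t
  size-unique a b = sumOver-unique (size⇒sumOver a) (size⇒sumOver b)

  sumOver-exists : ∀ {P : Subset n} {f v} → SumOver P f v → ∀ g → ∃ (SumOver P g)
  sumOver-exists (l , u , mem , _) g = _ , l , u , mem , refl

  sumOver-dec : ∀ {P : Subset n} {f v} → SumOver P f v → Decidable P
  sumOver-dec (l , u , mem , _) x with x ∈? l
    where open DecMembership _≟ᵥ_
  ... | yes x∈l = yes (to (mem x) x∈l)
  ... | no x∉l = no λ px → x∉l (from (mem x) px)

  sumOver-ext : ∀ {P Q : Subset n} {f v} → P ⊆ Q → Q ⊆ P → SumOver P f v → SumOver Q f v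
  sumOver-ext P⊆Q Q⊆P (l , u , mem , e) = l , u , (λ x → mk⇔ (P⊆Q x ∘ to (mem x)) (from (mem x) ∘ Q⊆P x)) , e

  size-ext : ∀ {P Q : Subset n} {s} → P ⊆ Q → Q ⊆ P → Size P s → Size Q s
  size-ext P⊆Q Q⊆P = sumOver⇒size ∘ sumOver-ext P⊆Q Q⊆P ∘ size⇒sumOver

  sumOver-cong : ∀ {P : Subset n} {f g v} → (∀ x → P x → f x ≡ g x) → SumOver P f v → SumOver P g v
  sumOver-cong {f = f} {g} f≡g (l , u , mem , e) = l , u , mem , trans (sym (go l λ x x∈ → f≡g x (to (mem x) x∈))) e
    where
    go : ∀ l → (∀ x → x ∈ l → f x ≡ g x) → sum (map f l) ≡ sum (map g l)
    go [] _ = refl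
    go (x ∷ l) eq = cong₂ _+_ (eq x (here refl)) (go l λ y y∈ → eq y (there y∈))

  sumOver-const : ∀ {P : Subset n} {s} c → Size P s → SumOver P (λ _ → c) (c * s)
  sumOver-const c (l , u , mem , refl) = l , u , mem , go l
    where
    go : ∀ l → sum (map (λ _ → c) l) ≡ c * length l
    go [] = sym (ℕ.*-zeroʳ c)
    go (x ∷ l) = trans (cong (c +_) (go l)) (sym (ℕ.*-suc c (length l)))

  sumOver-zero : ∀ {P : Subset n} {f v} → (∀ x → P x → f x ≡ 0) → SumOver P f v → v ≡ 0
  sumOver-zero f≡0 sP@(l , u , mem , _) = sumOver-unique (sumOver-cong f≡0 sP) (sumOver-const 0 (l , u , mem , refl))

  sum-map-+ : ∀ (f g : Pt n → ℕ) l → sum (map (λ x → f x + g x) l) ≡ sum (map f l) + sum (map g l)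
  sum-map-+ f g [] = refl
  sum-map-+ f g (x ∷ l) = trans (cong (f x + g x +_) (sum-map-+ f g l)) (interchange (f x) (g x) _ _)

  sumOver-+ : ∀ {P : Subset n} {f g v w} → SumOver P f v → SumOver P g w → SumOver P (λ x → f x + g x) (v + w)
  sumOver-+ {f = f} {g} (l , u , mem , refl) sg =
    l , u , mem , trans (sum-map-+ f g l) (cong (sum (map f l) +_) (sumOver-unique (l , u , mem , refl) sg))

  private
    sum-map-filter : ∀ {R : Subset n} (R? : Decidable R) f l →
      sum (map f l) ≡ sum (map f (filter R? l)) + sum (map f (filter (∁? R?) l))
    sum-map-filter R? f [] = refl
    sum-map-filter R? f (x ∷ l) with R? x
    ... | yes _ = trans (cong (f x +_) (sum-map-filter R? f l)) (sym (ℕ.+-assoc (f x) _ _))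
    ... | no _ = trans (cong (f x +_) (sum-map-filter R? f l)) (x∙yz≈y∙xz (f x) (sum (map f (filter R? l))) _)

    restrict : ∀ {P R : Subset n} (R? : Decidable R) l → (∀ x → x ∈ l ⇔ P x) → ∀ x → x ∈ filter R? l ⇔ (P ∩ R) x
    restrict R? l mem x = mk⇔ (λ x∈ → let (x∈l , rx) = ∈-filter⁻ R? x∈ in to (mem x) x∈l , rx)
                            (λ (px , rx) → ∈-filter⁺ R? (from (mem x) px) rx)

  sumOver-restrict : ∀ {P R : Subset n} {f v} → Decidable R → SumOver P f v → ∃ (SumOver (P ∩ R) f)
  sumOver-restrict R? (l , u , mem , _) = _ , filter R? l , filter⁺ R? u , restrict R? l mem , refl

  sumOver-split : ∀ {P R : Subset n} {f v v₁ v₂} → Decidable R → SumOver P f v →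
    SumOver (P ∩ R) f v₁ → SumOver (P ∩ ∁ R) f v₂ → v ≡ v₁ + v₂
  sumOver-split {f = f} R? (l , u , mem , refl) s₁ s₂ =
    trans (sum-map-filter R? f l)
          (cong₂ _+_ (sumOver-unique (filter R? l , filter⁺ R? u , restrict R? l mem , refl) s₁)
                     (sumOver-unique (filter (∁? R?) l , filter⁺ (∁? R?) u , restrict (∁? R?) l mem , refl) s₂))

  sumOver-mono : ∀ {P Q : Subset n} {f v w} → Q ⊆ P → SumOver Q f v → SumOver P f w → v ≤ w
  sumOver-mono Q⊆P sQ sP with sumOver-restrict (sumOver-dec sQ) sP | sumOver-restrict (∁? (sumOver-dec sQ)) sP
  ... | (v₁ , s₁) | (v₂ , s₂) =
    subst₂ _≤_ (sumOver-unique (sumOver-ext (λ _ → proj₂) (λ x qx → Q⊆P x qx , qx) s₁) sQ)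
               (sym (sumOver-split (sumOver-dec sQ) sP s₁ s₂)) (ℕ.m≤m+n v₁ v₂)

  size-mono : ∀ {P Q : Subset n} {s t} → Q ⊆ P → Size Q s → Size P t → s ≤ t
  size-mono Q⊆P sQ sP = sumOver-mono Q⊆P (size⇒sumOver sQ) (size⇒sumOver sP)

  size-strict : ∀ {P Q : Subset n} {s t} → Q ⊆ P → ∀ w → P w → ¬ Q w → Size Q s → Size P t → s < t
  size-strict {P} {Q} Q⊆P w pw w∉Q (l , u , mem , refl) sP = size-mono Q+w⊆P (w ∷ l , fresh ∷ u , mem' , refl) sP
    where
    Q+w : Subset n
    Q+w x = x ≡ w ⊎ Q x
    Q+w⊆P : Q+w ⊆ P
    Q+w⊆P x (inj₁ refl) = pw
    Q+w⊆P x (inj₂ qx) = Q⊆P x qx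
    fresh : All.All (w ≢_) l
    fresh = All.tabulate λ {x} x∈ w≡x → w∉Q (subst Q (sym w≡x) (to (mem x) x∈))
    mem' : ∀ x → x ∈ w ∷ l ⇔ Q+w x
    mem' x = mk⇔ (λ { (here x≡w) → inj₁ x≡w ; (there x∈) → inj₂ (to (mem x) x∈) })
               (λ { (inj₁ x≡w) → here x≡w ; (inj₂ qx) → there (from (mem x) qx) })

  sumOver-bound : ∀ {P : Subset n} {f v} → SumOver P f v → ∀ (c : Pt n → ℕ) → ∃ λ B → ∀ x → P x → c x ≤ B
  sumOver-bound (l , u , mem , _) c = sum (map c l) , λ x px → go l (from (mem x) px)
    where
    go : ∀ {x} l → x ∈ l → c x ≤ sum (map c l)
    go (y ∷ l) (here refl) = ℕ.m≤m+n (c y) _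
    go (y ∷ l) (there x∈) = ℕ.≤-trans (go l x∈) (ℕ.m≤n+m _ (c y))

  level? : (c : Pt n → ℕ) → ∀ a → Decidable (λ x → c x ≡ a)
  level? c a x = c x ≟ a

  sumOver-≤-by-cases : ∀ {P Q R : Subset n} {f g v w} → Decidable R →
    (∀ {v w} → SumOver (P ∩ R) f v → SumOver (Q ∩ R) g w → v ≤ w) →
    (∀ {v w} → SumOver (P ∩ ∁ R) f v → SumOver (Q ∩ ∁ R) g w → v ≤ w) →
    SumOver P f v → SumOver Q g w → v ≤ w
  sumOver-≤-by-cases R? inside outside sP sQ =
    let (_ , sP₁) = sumOver-restrict R? sP ; (_ , sP₂) = sumOver-restrict (∁? R?) sP
        (_ , sQ₁) = sumOver-restrict R? sQ ; (_ , sQ₂) = sumOver-restrict (∁? R?) sQ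
    in subst₂ _≤_ (sym (sumOver-split R? sP sP₁ sP₂)) (sym (sumOver-split R? sQ sQ₁ sQ₂))
         (ℕ.+-mono-≤ (inside sP₁ sQ₁) (outside sP₂ sQ₂))

  sumOver-levelwise-≤ : ∀ {P Q : Subset n} {f g v w} (c : Pt n → ℕ) B → (∀ x → P x → c x ≤ B) →
    (∀ a → a ≤ B → ∀ {v w} → SumOver (Level c P a) f v → SumOver (Level c Q a) g w → v ≤ w) →
    SumOver P f v → SumOver Q g w → v ≤ w
  sumOver-levelwise-≤ c zero P≤0 levels = sumOver-≤-by-cases (level? c 0) (levels 0 z≤n)
    λ sP' _ → subst (_≤ _) (sym (sumOver-zero (λ x (px , c≢0) → ⊥-elim (c≢0 (ℕ.n≤0⇒n≡0 (P≤0 x px)))) sP')) z≤n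
  sumOver-levelwise-≤ {P} {Q} {f} {g} c (suc B) P≤B levels = sumOver-≤-by-cases (level? c (suc B)) (levels (suc B) ℕ.≤-refl)
    (sumOver-levelwise-≤ c B (λ x (px , c≢B) → ℕ.≤-pred (ℕ.≤∧≢⇒< (P≤B x px) c≢B)) below)
    where
    keep : ∀ {R : Subset n} a → a ≤ B → Level c R a ⊆ Level c (R ∩ ∁ (λ x → c x ≡ suc B)) a
    keep a a≤B x (rx , refl) = (rx , λ c≡ → ℕ.<⇒≱ (s≤s a≤B) (ℕ.≤-reflexive (sym c≡))) , refl
    below : ∀ a → a ≤ B → ∀ {v w} → SumOver (Level c (P ∩ ∁ (λ x → c x ≡ suc B)) a) f v →
      SumOver (Level c (Q ∩ ∁ (λ x → c x ≡ suc B)) a) g w → v ≤ w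
    below a a≤B s₁ s₂ = levels a (ℕ.m≤n⇒m≤1+n a≤B)
      (sumOver-ext (λ x ((px , _) , e) → px , e) (keep a a≤B) s₁)
      (sumOver-ext (λ x ((qx , _) , e) → qx , e) (keep a a≤B) s₂)

  sumOver-cover : ∀ {P : Subset n} → Decidable P → (l : List (Pt n)) → (∀ x → P x → x ∈ l) → ∀ f → ∃ (SumOver P f)
  sumOver-cover P? l cover f =
    _ , deduplicate _≟ᵥ_ (filter P? l) , deduplicate-! _≟ᵥ_ (filter P? l) ,
    (λ x → mk⇔ (λ x∈ → proj₂ (∈-filter⁻ P? {xs = l} (∈-deduplicate⁻ _≟ᵥ_ (filter P? l) x∈)))
               (λ px → ∈-deduplicate⁺ _≟ᵥ_ (∈-filter⁺ P? (cover x px) px))) , refl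

  sumOver-Σ : ∀ {m} {P : Subset n} {s} → Size P s → (f : Fin m → Pt n → ℕ) (p : Fin m → ℕ) →
    (∀ k → SumOver P (f k) (p k)) → SumOver P (λ x → Vec.sum (tabulate λ k → f k x)) (Vec.sum (tabulate p))
  sumOver-Σ {zero} sP f p _ =
    sumOver-const 0 sP
  sumOver-Σ {suc m} sP f p sums = sumOver-+ (sums fzero) (sumOver-Σ sP (f ∘ fsuc) (p ∘ fsuc) (sums ∘ fsuc))

module _ {n m : ℕ} where

  unique-map⁺ : ∀ (h : Pt n → Pt m) l → (∀ {x y} → x ∈ l → y ∈ l → h x ≡ h y → x ≡ y) →
    Unique l → Unique (map h l)
  unique-map⁺ h [] _ _ = []
  unique-map⁺ h (x ∷ l) inj (x∉ ∷ u) =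
    All.map⁺ (All.tabulate λ y∈ hx≡hy → All.lookup x∉ y∈ (inj (here refl) (there y∈) hx≡hy))
    ∷ unique-map⁺ h l (λ x∈ y∈ → inj (there x∈) (there y∈)) u

  sumOver-image : ∀ {P : Subset n} {Q : Subset m} (h : Pt n → Pt m) {g : Pt m → ℕ} {v} →
    (∀ x → P x → Q (h x)) → (∀ x y → P x → P y → h x ≡ h y → x ≡ y) →
    (∀ y → Q y → ∃ λ x → P x × h x ≡ y) →
    SumOver P (g ∘ h) v → SumOver Q g v
  sumOver-image {Q = Q} h {g} P→Q inj onto (l , u , mem , e) =
    map h l , unique-map⁺ h l (λ x∈ y∈ → inj _ _ (to (mem _) x∈) (to (mem _) y∈)) u ,
    (λ y → mk⇔ (λ y∈ → let (x , x∈ , y≡) = ∈-map⁻ h y∈ in subst Q (sym y≡) (P→Q x (to (mem x) x∈)))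
               (λ qy → let (x , px , hx≡y) = onto y qy in subst (_∈ map h l) hx≡y (∈-map⁺ h (from (mem x) px)))) ,
    trans (cong sum (sym (map-∘ l))) e

  finite-via-section : ∀ {A : Subset m} {P : Subset n} {s} (g : Pt n → Pt m) (r : Pt m → Pt n) →
    (∀ u → r (g u) ≡ u) → Decidable P → (∀ u → P u → A (g u)) → Size A s → ∃ (Size P)
  finite-via-section g r r∘g P? P→A (l , _ , mem , _) =
    let (s , sP) = sumOver-cover P? (map r l)
                     (λ u pu → subst (_∈ map r l) (r∘g u) (∈-map⁺ r (from (mem _) (P→A u pu)))) (λ _ → 1)
    in s , sumOver⇒size sP

-- Points and the pointwise order

infix 4 _≼_

record _≼_ {n} (x y : Pt n) : Set where
  constructor pointwise
  field ≤-at : ∀ k → lookup x k ≤ lookup y k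

open _≼_ public

module _ {n : ℕ} where

  vec-ext : ∀ {x y : Pt n} → (∀ k → lookup x k ≡ lookup y k) → x ≡ y
  vec-ext {x} {y} eq = trans (sym (tabulate∘lookup x)) (trans (tabulate-cong eq) (tabulate∘lookup y))

  ≼-refl : ∀ {x : Pt n} → x ≼ x
  ≼-refl = pointwise λ _ → ℕ.≤-refl

  ≔0-≼ : ∀ (x : Pt n) k → (x [ k ]≔ 0) ≼ x
  ≔0-≼ x k = pointwise at
    where
    at : ∀ l → lookup (x [ k ]≔ 0) l ≤ lookup x l
    at l with l Fin.≟ k
    ... | yes refl = subst (_≤ lookup x l) (sym (lookup∘update l x 0)) z≤n
    ... | no l≢k = ℕ.≤-reflexive (lookup∘update′ l≢k x 0)

  ≼-≔0 : ∀ {x y : Pt n} k → x ≼ y → lookup x k ≡ 0 → x ≼ (y [ k ]≔ 0)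
  ≼-≔0 {x} {y} k x≼y xₖ≡0 = pointwise at
    where
    at : ∀ l → lookup x l ≤ lookup (y [ k ]≔ 0) l
    at l with l Fin.≟ k
    ... | yes refl = subst₂ _≤_ (sym xₖ≡0) (sym (lookup∘update l y 0)) z≤n
    ... | no l≢k = subst (lookup x l ≤_) (sym (lookup∘update′ l≢k y 0)) (≤-at x≼y l)

  X-≼ : ∀ {x y : Pt n} → x ≼ y → X n y → X n x
  X-≼ x≼y (k , yₖ≡0) = k , ℕ.n≤0⇒n≡0 (subst (_ ≤_) yₖ≡0 (≤-at x≼y k))

  X-≔0 : ∀ (x : Pt n) k → X n (x [ k ]≔ 0)
  X-≔0 x k = k , lookup∘update k x 0

  ¬X⇒Pos : ∀ (x : Pt n) → ¬ X n x → Pos n x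
  ¬X⇒Pos x ¬X k with lookup x k in eq
  ... | zero = ⊥-elim (¬X (k , eq))
  ... | suc _ = s≤s z≤n

  Pos⇒¬X : ∀ (x : Pt n) → Pos n x → ¬ X n x
  Pos⇒¬X x pos (k , xₖ≡0) = ℕ.<⇒≢ (pos k) (sym xₖ≡0)

  X? : ∀ (x : Pt n) → Dec (X n x)
  X? x = Fin.any? (λ k → lookup x k ≟ 0)

  Pos? : ∀ (x : Pt n) → Dec (Pos n x)
  Pos? x = Fin.all? (λ k → 0 ℕ.<? lookup x k)

isZero : ℕ → ℕ
isZero zero = 1
isZero (suc _) = 0

zeros : ∀ {n} → Pt n → ℕ
zeros x = Vec.sum (tabulate λ k → isZero (lookup x k))

zeros-Pos : ∀ {n} (x : Pt n) → Pos n x → zeros x ≡ 0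
zeros-Pos [] _ = refl
zeros-Pos (zero ∷ x) pos = ⊥-elim (ℕ.<-irrefl refl (pos fzero))
zeros-Pos (suc _ ∷ x) pos = zeros-Pos x (pos ∘ fsuc)

zeros-insertAt : ∀ {n} (u : Pt n) i a → zeros (insertAt u i a) ≡ isZero a + zeros u
zeros-insertAt u fzero a = refl
zeros-insertAt (b ∷ u) (fsuc i) a =
  trans (cong (isZero b +_) (zeros-insertAt u i a)) (x∙yz≈y∙xz (isZero b) (isZero a) (zeros u))

module _ {n : ℕ} (i : Fin (suc n)) where

  lookup-removeAt : ∀ (x : Pt (suc n)) l → lookup (removeAt x i) l ≡ lookup x (punchIn i l)
  lookup-removeAt x l =
    trans (sym (insertAt-punchIn (removeAt x i) i (lookup x i) l)) (cong (λ y → lookup y (punchIn i l)) (insertAt-removeAt x i))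

  punchIn-cases : ∀ {P : Fin (suc n) → Set} → P i → (∀ l → P (punchIn i l)) → ∀ k → P k
  punchIn-cases {P} pᵢ p k with k Fin.≟ i
  ... | yes refl = pᵢ
  ... | no k≢i = subst P (Fin.punchIn-punchOut (k≢i ∘ sym)) (p (punchOut (k≢i ∘ sym)))

  removeAt-injective : ∀ {x y : Pt (suc n)} → removeAt x i ≡ removeAt y i → lookup x i ≡ lookup y i → x ≡ y
  removeAt-injective {x} {y} rx≡ry xᵢ≡yᵢ =
    trans (sym (insertAt-removeAt x i)) (trans (cong₂ (λ u a → insertAt u i a) rx≡ry xᵢ≡yᵢ) (insertAt-removeAt y i))

  insertAt-injective : ∀ {u v : Pt n} {a b} → insertAt u i a ≡ insertAt v i b → u ≡ v
  insertAt-injective {u} {v} {a} {b} eq =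
    trans (sym (removeAt-insertAt u i a)) (trans (cong (λ w → removeAt w i) eq) (removeAt-insertAt v i b))

  insertAt-removeAt-≔ : ∀ (x : Pt (suc n)) c → insertAt (removeAt x i) i c ≡ x [ i ]≔ c
  insertAt-removeAt-≔ x c = vec-ext (punchIn-cases
    (trans (insertAt-lookup _ i c) (sym (lookup∘update i x c)))
    λ l → trans (insertAt-punchIn _ i c l)
                (trans (lookup-removeAt x l) (sym (lookup∘update′ (Fin.punchInᵢ≢i i l) x c))))

  insertAt-≔ : ∀ (u : Pt n) k c a → insertAt (u [ k ]≔ c) i a ≡ insertAt u i a [ punchIn i k ]≔ c
  insertAt-≔ u k c a = vec-ext (punchIn-cases
    (trans (insertAt-lookup _ i a)
           (sym (trans (lookup∘update′ (Fin.punchInᵢ≢i i k ∘ sym) (insertAt u i a) c) (insertAt-lookup u i a))))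
    λ l → trans (insertAt-punchIn _ i a l) (punched l))
    where
    punched : ∀ l → lookup (u [ k ]≔ c) l ≡ lookup (insertAt u i a [ punchIn i k ]≔ c) (punchIn i l)
    punched l with l Fin.≟ k
    ... | yes refl = trans (lookup∘update l u c) (sym (lookup∘update (punchIn i l) (insertAt u i a) c))
    ... | no l≢k = trans (lookup∘update′ l≢k u c)
      (sym (trans (lookup∘update′ (l≢k ∘ Fin.punchIn-injective i l k) (insertAt u i a) c) (insertAt-punchIn u i a l)))

  insertAt-mono : ∀ {u v : Pt n} {a b} → u ≼ v → a ≤ b → insertAt u i a ≼ insertAt v i b
  insertAt-mono {u} {v} {a} {b} u≼v a≤b = pointwise (punchIn-cases
    (subst₂ _≤_ (sym (insertAt-lookup u i a)) (sym (insertAt-lookup v i b)) a≤b)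
    λ l → subst₂ _≤_ (sym (insertAt-punchIn u i a l)) (sym (insertAt-punchIn v i b l)) (≤-at u≼v l))

  removeAt-mono : ∀ {x y : Pt (suc n)} → x ≼ y → removeAt x i ≼ removeAt y i
  removeAt-mono {x} {y} x≼y = pointwise λ l →
    subst₂ _≤_ (sym (lookup-removeAt x l)) (sym (lookup-removeAt y l)) (≤-at x≼y (punchIn i l))

  X-¬X-removeAt : ∀ (x : Pt (suc n)) → X (suc n) x → ¬ X n (removeAt x i) → lookup x i ≡ 0
  X-¬X-removeAt x (k , xₖ≡0) ¬X = punchIn-cases {λ k → lookup x k ≡ 0 → lookup x i ≡ 0} (λ e → e)
    (λ l xₗ≡0 → ⊥-elim (¬X (l , trans (lookup-removeAt x l) xₗ≡0))) k xₖ≡0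

  Pos-insertAt : ∀ (u : Pt n) {a} → Pos n u → 0 < a → Pos (suc n) (insertAt u i a)
  Pos-insertAt u {a} pos 0<a = punchIn-cases (subst (0 <_) (sym (insertAt-lookup u i a)) 0<a)
    λ l → subst (0 <_) (sym (insertAt-punchIn u i a l)) (pos l)

  Pos-removeAt : ∀ (x : Pt (suc n)) → Pos (suc n) x → Pos n (removeAt x i)
  Pos-removeAt x pos l = subst (0 <_) (sym (lookup-removeAt x l)) (pos (punchIn i l))


-- The balanced order

maxList-≥ : ∀ {x} l → x ∈ l → x ≤ maxList l
maxList-≥ (y ∷ l) (here refl) = ℕ.m≤m⊔n y (maxList l)
maxList-≥ (y ∷ l) (there x∈) = ℕ.≤-trans (maxList-≥ l x∈) (ℕ.m≤n⊔m y (maxList l))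

maxList-≤ : ∀ {c} l → (∀ x → x ∈ l → x ≤ c) → maxList l ≤ c
maxList-≤ [] _ = z≤n
maxList-≤ (y ∷ l) bound = ℕ.⊔-lub (bound y (here refl)) (maxList-≤ l λ x x∈ → bound x (there x∈))

module _ {n : ℕ} where

  maxFin-≥ : ∀ (f : Fin n → ℕ) k → f k ≤ maxList (map f (allFin n))
  maxFin-≥ f k = maxList-≥ (map f (allFin n)) (∈-map⁺ f (∈-allFin k))

  maxFin-≤ : ∀ (f : Fin n → ℕ) {c} → (∀ k → f k ≤ c) → maxList (map f (allFin n)) ≤ c
  maxFin-≤ f {c} bound = maxList-≤ (map f (allFin n)) λ x x∈ →
    let (k , _ , x≡fk) = ∈-map⁻ f x∈ in subst (_≤ c) (sym x≡fk) (bound k)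

argmax : ∀ {n} {P : Fin n → Set} → (∀ k → Dec (P k)) → (f : Fin n → ℕ) →
  ∀ k → P k → ∃ λ j → P j × ∀ l → P l → f l ≤ f j
argmax {suc n} P? f k pk with Fin.any? (P? ∘ fsuc)
argmax {suc n} P? f fzero p₀ | no none = fzero , p₀ , λ { fzero _ → ℕ.≤-refl ; (fsuc l) pl → ⊥-elim (none (l , pl)) }
argmax {suc n} P? f (fsuc k) pk | no none = ⊥-elim (none (k , pk))
argmax {suc n} P? f k pk | yes (k' , pk') with argmax (P? ∘ fsuc) (f ∘ fsuc) k' pk' | P? fzero
... | (j , pj , maxⱼ) | no ¬p₀ = fsuc j , pj , λ { fzero p₀ → ⊥-elim (¬p₀ p₀) ; (fsuc l) pl → maxⱼ l pl }
... | (j , pj , maxⱼ) | yes p₀ with f fzero ≤? f (fsuc j)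
...   | yes f₀≤ = fsuc j , pj , λ { fzero _ → f₀≤ ; (fsuc l) pl → maxⱼ l pl }
...   | no f₀≰ =
  fzero , p₀ , λ { fzero _ → ℕ.≤-refl ; (fsuc l) pl → ℕ.≤-trans (maxⱼ l pl) (ℕ.<⇒≤ (ℕ.≰⇒> f₀≰)) }

_<ₗ_ _≤ₗ_ : ∀ {n} → ℕ × Fin n → ℕ × Fin n → Set
_<ₗ_ = ×-Lex _≡_ _<_ _<ᶠ_
_≤ₗ_ = ×-Lex _≡_ _<_ _≤ᶠ_

lex-≤₁ : ∀ {n} {R : Fin n → Fin n → Set} {a b l j} → ×-Lex _≡_ _<_ R (a , l) (b , j) → a ≤ b
lex-≤₁ (inj₁ a<b) = ℕ.<⇒≤ a<b
lex-≤₁ (inj₂ (a≡b , _)) = ℕ.≤-reflexive a≡b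

module _ {m n : ℕ} {a a' b b' : ℕ} {l j : Fin m} {l' j' : Fin n} (a≡a' : a ≡ a') (b≡b' : b ≡ b') where

  <ₗ-resp : (l <ᶠ j → l' <ᶠ j') → (a , l) <ₗ (b , j) → (a' , l') <ₗ (b' , j')
  <ₗ-resp _ (inj₁ a<b) = inj₁ (subst₂ _<_ a≡a' b≡b' a<b)
  <ₗ-resp f (inj₂ (a≡b , l<j)) = inj₂ (trans (sym a≡a') (trans a≡b b≡b') , f l<j)

  ≤ₗ-resp : (l ≤ᶠ j → l' ≤ᶠ j') → (a , l) ≤ₗ (b , j) → (a' , l') ≤ₗ (b' , j')
  ≤ₗ-resp _ (inj₁ a<b) = inj₁ (subst₂ _<_ a≡a' b≡b' a<b)
  ≤ₗ-resp f (inj₂ (a≡b , l≤j)) = inj₂ (trans (sym a≡a') (trans a≡b b≡b') , f l≤j)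

module _ {n : ℕ} where

  Differ : Pt n → Pt n → Fin n → Set
  Differ x y k = lookup x k ≢ lookup y k

  Differ? : ∀ x y k → Dec (Differ x y k)
  Differ? x y k = ¬? (lookup x k ≟ lookup y k)

  ≢⇒differ : ∀ {x y : Pt n} → x ≢ y → ∃ (Differ x y)
  ≢⇒differ {x} {y} x≢y with Fin.any? (Differ? x y)
  ... | yes d = d
  ... | no none = ⊥-elim (x≢y (vec-ext λ k → decidable-stable (lookup x k ≟ lookup y k) λ d → none (k , d)))

  Top : Pt n → Pt n → Fin n → Set
  Top x y k = Differ x y k × lookup x k ≡ Mx x y

  Top? : ∀ x y k → Dec (Top x y k)
  Top? x y k with Differ? x y k | lookup x k ≟ Mx x y
  ... | yes d | yes e = yes (d , e)
  ... | no ¬d | _ = no (¬d ∘ proj₁)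
  ... | _ | no ¬e = no (¬e ∘ proj₂)

  private
    masked-in : ∀ x y k {a b : ℕ} → Differ x y k → (if differs x y k then a else b) ≡ a
    masked-in x y k d rewrite dec-false (lookup x k ≟ lookup y k) d = refl

    masked-out : ∀ x y k {a b : ℕ} → ¬ Differ x y k → (if differs x y k then a else b) ≡ b
    masked-out x y k ¬d rewrite dec-true (lookup x k ≟ lookup y k) (decidable-stable (lookup x k ≟ lookup y k) ¬d) = refl

    top-in : ∀ x y k {a b : ℕ} → Top x y k → (if differs x y k ∧ does (lookup x k ≟ Mx x y) then a else b) ≡ a
    top-in x y k (d , e) rewrite dec-false (lookup x k ≟ lookup y k) d | dec-true (lookup x k ≟ Mx x y) e = refl

    top-out : ∀ x y k {a b : ℕ} → ¬ Top x y k → (if differs x y k ∧ does (lookup x k ≟ Mx x y) then a else b) ≡ b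
    top-out x y k ¬t with Differ? x y k
    ... | no ¬d rewrite dec-true (lookup x k ≟ lookup y k) (decidable-stable (lookup x k ≟ lookup y k) ¬d) = refl
    ... | yes d rewrite dec-false (lookup x k ≟ lookup y k) d | dec-false (lookup x k ≟ Mx x y) (¬t ∘ (d ,_)) = refl

  Mx-≥ : ∀ x y {k} → Differ x y k → lookup x k ≤ Mx x y
  Mx-≥ x y {k} d = subst (_≤ Mx x y) (masked-in x y k d) (maxFin-≥ _ k)

  Mx-≤ : ∀ x y {c} → (∀ k → Differ x y k → lookup x k ≤ c) → Mx x y ≤ c
  Mx-≤ x y {c} bound = maxFin-≤ _ λ k → bounded k (Differ? x y k)
    where
    bounded : ∀ k → Dec (Differ x y k) → (if differs x y k then lookup x k else 0) ≤ c
    bounded k (yes d) = subst (_≤ c) (sym (masked-in x y k d)) (bound k d)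
    bounded k (no ¬d) = subst (_≤ c) (sym (masked-out x y k ¬d)) z≤n

  Mx-attained : ∀ x y {k} → Differ x y k → ∃ (Top x y)
  Mx-attained x y {k} d with argmax (Differ? x y) (lookup x) k d
  ... | (j , dⱼ , maxⱼ) = j , dⱼ , ℕ.≤-antisym (Mx-≥ x y dⱼ) (Mx-≤ x y maxⱼ)

  Jx-≥ : ∀ x y {k} → Top x y k → toℕ k ≤ Jx x y
  Jx-≥ x y {k} t = subst (_≤ Jx x y) (top-in x y k t) (maxFin-≥ _ k)

  Jx-attained : ∀ x y {k} → Differ x y k → ∃ λ j → Top x y j × Jx x y ≡ toℕ j × ∀ l → Top x y l → l ≤ᶠ j
  Jx-attained x y d with argmax (Top? x y) toℕ _ (proj₂ (Mx-attained x y d))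
  ... | (j , tⱼ , maxⱼ) = j , tⱼ , ℕ.≤-antisym (maxFin-≤ _ bounded) (Jx-≥ x y tⱼ) , maxⱼ
    where
    bounded : ∀ k → (if differs x y k ∧ does (lookup x k ≟ Mx x y) then toℕ k else 0) ≤ toℕ j
    bounded k with Top? x y k
    ... | yes t = subst (_≤ toℕ j) (sym (top-in x y k t)) (maxⱼ k t)
    ... | no ¬t = subst (_≤ toℕ j) (sym (top-out x y k ¬t)) z≤n

  top-≥ₗ : ∀ x y {j} → Top x y j → (∀ l → Top x y l → l ≤ᶠ j) →
    ∀ l → Differ x y l → (lookup x l , l) ≤ₗ (lookup x j , j)
  top-≥ₗ x y {j} (_ , xⱼ≡M) maxⱼ l d with ℕ.m≤n⇒m<n∨m≡n (Mx-≥ x y d)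
  ... | inj₁ xₗ<M = inj₁ (subst (lookup x l <_) (sym xⱼ≡M) xₗ<M)
  ... | inj₂ xₗ≡M = inj₂ (trans xₗ≡M (sym xⱼ≡M) , maxⱼ l (d , xₗ≡M))

  -- j realises (M_y, max{k ∈ T : y_k = M_y}) in the definition of x <b y.
  BalWitness : Pt n → Pt n → Set
  BalWitness x y = ∃ λ j → Differ x y j × ∀ l → Differ x y l →
    (lookup x l , l) <ₗ (lookup y j , j) × (lookup y l , l) ≤ₗ (lookup y j , j)

  <b⇒witness : ∀ {x y} → x <b y → BalWitness x y
  <b⇒witness {x} {y} (x≢y , order) with ≢⇒differ x≢y
  ... | (k , d) with Jx-attained y x (≢-sym d)
  ... | (j , (dⱼ , yⱼ≡M) , Jy≡j , maxⱼ) =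
    j , ≢-sym dⱼ , λ l dₗ → x-below l dₗ order , top-≥ₗ y x (dⱼ , yⱼ≡M) maxⱼ l (≢-sym dₗ)
    where
    x-below : ∀ l → Differ x y l → Mx x y < Mx y x ⊎ (Mx x y ≡ Mx y x × Jx x y < Jx y x) →
      (lookup x l , l) <ₗ (lookup y j , j)
    x-below l dₗ (inj₁ Mx<My) = inj₁ (ℕ.≤-<-trans (Mx-≥ x y dₗ) (subst (Mx x y <_) (sym yⱼ≡M) Mx<My))
    x-below l dₗ (inj₂ (Mx≡My , Jx<Jy)) with ℕ.m≤n⇒m<n∨m≡n (Mx-≥ x y dₗ)
    ... | inj₁ xₗ<M = inj₁ (subst (lookup x l <_) (trans Mx≡My (sym yⱼ≡M)) xₗ<M)
    ... | inj₂ xₗ≡M with Jx-attained x y d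
    ...   | (_ , _ , Jx≡j' , maxⱼ') =
      inj₂ (trans xₗ≡M (trans Mx≡My (sym yⱼ≡M)) ,
            ℕ.≤-<-trans (maxⱼ' l (dₗ , xₗ≡M)) (subst₂ _<_ Jx≡j' Jy≡j Jx<Jy))

  witness⇒<b : ∀ {x y} → BalWitness x y → x <b y
  witness⇒<b {x} {y} (j , dⱼ , dominated) = (λ x≡y → dⱼ (cong (λ v → lookup v j) x≡y)) , order
    where
    yⱼ≤My : lookup y j ≤ Mx y x
    yⱼ≤My = Mx-≥ y x (≢-sym dⱼ)
    Mx≤yⱼ : Mx x y ≤ lookup y j
    Mx≤yⱼ = Mx-≤ x y λ l dₗ → lex-≤₁ {R = _<ᶠ_} (proj₁ (dominated l dₗ))
    yⱼ≡My : lookup y j ≡ Mx y x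
    yⱼ≡My = ℕ.≤-antisym yⱼ≤My (Mx-≤ y x λ l dₗ → lex-≤₁ {R = _≤ᶠ_} (proj₂ (dominated l (≢-sym dₗ))))
    order : Mx x y < Mx y x ⊎ (Mx x y ≡ Mx y x × Jx x y < Jx y x)
    order with ℕ.m≤n⇒m<n∨m≡n Mx≤yⱼ
    ... | inj₁ Mx<yⱼ = inj₁ (ℕ.<-≤-trans Mx<yⱼ yⱼ≤My)
    ... | inj₂ Mx≡yⱼ with Jx-attained x y dⱼ
    ...   | (j' , (dⱼ' , xⱼ'≡M) , Jx≡j' , _) = inj₂ (trans Mx≡yⱼ yⱼ≡My ,
            subst (_< Jx y x) (sym Jx≡j') (ℕ.<-≤-trans j'<j (Jx-≥ y x (≢-sym dⱼ , yⱼ≡My))))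
      where
      j'<j : j' <ᶠ j
      j'<j with proj₁ (dominated j' dⱼ')
      ... | inj₁ xⱼ'<yⱼ = ⊥-elim (ℕ.<-irrefl (trans xⱼ'≡M Mx≡yⱼ) xⱼ'<yⱼ)
      ... | inj₂ (_ , j'<j) = j'<j

  <b-total : ∀ {x y : Pt n} → x ≢ y → x <b y ⊎ y <b x
  <b-total {x} {y} x≢y with ℕ.<-cmp (Mx x y) (Mx y x)
  ... | tri< Mx<My _ _ = inj₁ (x≢y , inj₁ Mx<My)
  ... | tri> _ _ My<Mx = inj₂ (x≢y ∘ sym , inj₁ My<Mx)
  ... | tri≈ _ Mx≡My _ with ℕ.<-cmp (Jx x y) (Jx y x)
  ...   | tri< Jx<Jy _ _ = inj₁ (x≢y , inj₂ (Mx≡My , Jx<Jy))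
  ...   | tri> _ _ Jy<Jx = inj₂ (x≢y ∘ sym , inj₂ (sym Mx≡My , Jy<Jx))
  ...   | tri≈ _ Jx≡Jy _ with ≢⇒differ x≢y
  ...     | (k , d) with Jx-attained x y d | Jx-attained y x (≢-sym d)
  ...       | (j , (dⱼ , xⱼ≡M) , Jx≡j , _) | (j' , (_ , yⱼ'≡M) , Jy≡j' , _) =
    ⊥-elim (dⱼ (trans xⱼ≡M (trans Mx≡My (trans (sym yⱼ'≡M) (cong (lookup y) (sym j≡j'))))))
    where
    j≡j' : j ≡ j'
    j≡j' = Fin.toℕ-injective (trans (sym Jx≡j) (trans Jx≡Jy Jy≡j'))

  ≼⇒<b : ∀ {x y : Pt n} → x ≼ y → x ≢ y → x <b y
  ≼⇒<b {x} {y} x≼y x≢y with ≢⇒differ x≢y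
  ... | (k , d) with Mx-attained x y d
  ...   | (j , dⱼ , xⱼ≡M) =
    x≢y , inj₁ (subst (_< Mx y x) xⱼ≡M (ℕ.<-≤-trans (ℕ.≤∧≢⇒< (≤-at x≼y j) dⱼ) (Mx-≥ y x (≢-sym dⱼ))))

punchIn-cancel-< : ∀ {n} (i : Fin (suc n)) {l j} → punchIn i l <ᶠ punchIn i j → l <ᶠ j
punchIn-cancel-< i {l} {j} lt = ℕ.≰⇒> λ j≤l → ℕ.<⇒≱ lt (Fin.punchIn-mono-≤ i j l j≤l)

witness-insertAt : ∀ {n} (i : Fin (suc n)) a {z y : Pt n} →
  BalWitness (insertAt z i a) (insertAt y i a) → BalWitness z y
witness-insertAt {n} i a {z} {y} (j , dⱼ , dominated) with j Fin.≟ i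
... | yes refl = ⊥-elim (dⱼ (trans (insertAt-lookup z i a) (sym (insertAt-lookup y i a))))
... | no j≢i = punched (punchOut (j≢i ∘ sym)) (Fin.punchIn-punchOut (j≢i ∘ sym)) dⱼ dominated
  where
  lookup-z : ∀ l → lookup (insertAt z i a) (punchIn i l) ≡ lookup z l
  lookup-z = insertAt-punchIn z i a
  lookup-y : ∀ l → lookup (insertAt y i a) (punchIn i l) ≡ lookup y l
  lookup-y = insertAt-punchIn y i a
  punched : ∀ j' → punchIn i j' ≡ j → Differ (insertAt z i a) (insertAt y i a) j →
    (∀ l → Differ (insertAt z i a) (insertAt y i a) l →
       (lookup (insertAt z i a) l , l) <ₗ (lookup (insertAt y i a) j , j) ×
       (lookup (insertAt y i a) l , l) ≤ₗ (lookup (insertAt y i a) j , j)) →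
    BalWitness z y
  punched j' refl dⱼ dominated = j' , (λ e → dⱼ (trans (lookup-z j') (trans e (sym (lookup-y j'))))) , λ l dₗ →
    let (x-below , y-below) = dominated (punchIn i l) (λ e → dₗ (trans (sym (lookup-z l)) (trans e (lookup-y l)))) in
    <ₗ-resp (lookup-z l) (lookup-y j') (punchIn-cancel-< i) x-below ,
    ≤ₗ-resp (lookup-y l) (lookup-y j') (Fin.punchIn-cancel-≤ i l j') y-below

-- Initial segments

Closed : ∀ {n} → Subset n → (Pt n → Pt n → Set) → Subset n → Set
Closed U R P = ∀ x y → U x → P y → R x y → P x

S-balClosed : ∀ {n} {I : Subset n} → Closed (X n) _<b_ I →
  ∀ {z y} → Pos n y → (∀ k → I (y [ k ]≔ 0)) → BalWitness z y → ∀ k → I (z [ k ]≔ 0)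
S-balClosed {n} {I} closed {z} {y} pos yₖ∈I (j , dⱼ , dominated) k with j Fin.≟ k
... | no j≢k = closed _ _ (X-≔0 z k) (yₖ∈I k) (witness⇒<b (j , dⱼ' , dominated'))
  where
  off-k : ∀ {l} → Differ (z [ k ]≔ 0) (y [ k ]≔ 0) l → l ≢ k
  off-k {l} d refl = d (trans (lookup∘update l z 0) (sym (lookup∘update l y 0)))
  dⱼ' : Differ (z [ k ]≔ 0) (y [ k ]≔ 0) j
  dⱼ' e = dⱼ (trans (sym (lookup∘update′ j≢k z 0)) (trans e (lookup∘update′ j≢k y 0)))
  dominated' : ∀ l → Differ (z [ k ]≔ 0) (y [ k ]≔ 0) l →
    (lookup (z [ k ]≔ 0) l , l) <ₗ (lookup (y [ k ]≔ 0) j , j) × (lookup (y [ k ]≔ 0) l , l) ≤ₗ (lookup (y [ k ]≔ 0) j , j)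
  dominated' l d =
    let l≢k = off-k d
        (x-below , y-below) =
          dominated l (λ e → d (trans (lookup∘update′ l≢k z 0) (trans e (sym (lookup∘update′ l≢k y 0))))) in
    <ₗ-resp (sym (lookup∘update′ l≢k z 0)) (sym (lookup∘update′ j≢k y 0)) (λ r → r) x-below ,
    ≤ₗ-resp (sym (lookup∘update′ l≢k y 0)) (sym (lookup∘update′ j≢k y 0)) (λ r → r) y-below
-- If the witness is the zeroed coordinate j, use y[j']≔0 for another coordinate j' where z and y differ:
-- at j it still has y_j > 0 = (z[j]≔0)_j.
... | yes refl with Fin.any? (λ l → Differ? z y l ×-dec ¬? (l Fin.≟ j))
...   | no only-j = subst I (vec-ext agree) (yₖ∈I j)
  where
  agree : ∀ l → lookup (y [ j ]≔ 0) l ≡ lookup (z [ j ]≔ 0) l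
  agree l with l Fin.≟ j
  ... | yes refl = trans (lookup∘update l y 0) (sym (lookup∘update l z 0))
  ... | no l≢j = trans (lookup∘update′ l≢j y 0)
    (trans (sym (decidable-stable (lookup z l ≟ lookup y l) λ d → only-j (l , d , l≢j))) (sym (lookup∘update′ l≢j z 0)))
...   | yes (j' , dⱼ' , j'≢j) = closed _ _ (X-≔0 z j) (yₖ∈I j') (witness⇒<b (j , dⱼ'' , dominated'))
  where
  yⱼ : lookup (y [ j' ]≔ 0) j ≡ lookup y j
  yⱼ = lookup∘update′ (j'≢j ∘ sym) y 0
  dⱼ'' : Differ (z [ j ]≔ 0) (y [ j' ]≔ 0) j
  dⱼ'' e = ℕ.<⇒≢ (pos j) (trans (sym (lookup∘update j z 0)) (trans e yⱼ))
  dominated' : ∀ l → Differ (z [ j ]≔ 0) (y [ j' ]≔ 0) l →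
    (lookup (z [ j ]≔ 0) l , l) <ₗ (lookup (y [ j' ]≔ 0) j , j) ×
    (lookup (y [ j' ]≔ 0) l , l) ≤ₗ (lookup (y [ j' ]≔ 0) j , j)
  dominated' l d with l Fin.≟ j
  ... | yes refl = inj₁ (subst₂ _<_ (sym (lookup∘update l z 0)) (sym yⱼ) (pos l)) , inj₂ (refl , Fin.≤-refl)
  ... | no l≢j with l Fin.≟ j'
  ...   | yes refl = <ₗ-resp (sym (lookup∘update′ l≢j z 0)) (sym yⱼ) (λ r → r) (proj₁ (dominated l dⱼ')) ,
                     inj₁ (subst₂ _<_ (sym (lookup∘update l y 0)) (sym yⱼ) (pos j))
  ...   | no l≢j' =
    let (x-below , y-below) =
          dominated l (λ e → d (trans (lookup∘update′ l≢j z 0) (trans e (sym (lookup∘update′ l≢j' y 0))))) in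
    <ₗ-resp (sym (lookup∘update′ l≢j z 0)) (sym yⱼ) (λ r → r) x-below ,
    ≤ₗ-resp (sym (lookup∘update′ l≢j' y 0)) (sym yⱼ) (λ r → r) y-below


initial-nested : ∀ {n} {U : Subset n} {R : Pt n → Pt n → Set} → (∀ x y → U x → U y → x ≢ y → R x y ⊎ R y x) →
  ∀ {P Q : Subset n} {s t} → P ⊆ U → Q ⊆ U → Closed U R P → Closed U R Q →
  Size P s → Size Q t → s ≤ t → P ⊆ Q
initial-nested total {P} {Q} P⊆U Q⊆U closedP closedQ sP sQ s≤t w pw with sumOver-dec (size⇒sumOver sQ) w
... | yes qw = qw
... | no ¬qw = ⊥-elim (ℕ.<⇒≱ (size-strict Q⊆P w pw ¬qw sQ sP) s≤t)
  where
  Q⊆P : Q ⊆ P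
  Q⊆P z qz with z ≟ᵥ w
  ... | yes refl = ⊥-elim (¬qw qz)
  ... | no z≢w with total z w (Q⊆U z qz) (P⊆U w pw) z≢w
  ...   | inj₁ zRw = closedP z w (Q⊆U z qz) pw zRw
  ...   | inj₂ wRz = ⊥-elim (¬qw (closedQ w z (P⊆U w pw) qz wRz))

module _ {n : ℕ} where

  balInit-≼-closed : ∀ {I : Subset n} {k} → BalInit n I k → ∀ {x y} → I y → x ≼ y → I x
  balInit-≼-closed (I⊆X , _ , closed) {x} {y} iy x≼y with x ≟ᵥ y
  ... | yes refl = iy
  ... | no x≢y = closed x y (X-≼ x≼y (I⊆X y iy)) iy (≼⇒<b x≼y x≢y)

  balInit-nested : ∀ {I J : Subset n} {s t} → BalInit n I s → BalInit n J t → s ≤ t → I ⊆ J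
  balInit-nested (I⊆X , sI , closedI) (J⊆X , sJ , closedJ) =
    initial-nested (λ x y _ _ → <b-total) I⊆X J⊆X closedI closedJ sI sJ

module _ {n : ℕ} (i : Fin (suc n)) where

  _≺_ : Pt n → Pt n → Set
  x ≺ y = insertAt x i 0 <b insertAt y i 0

  posInit-≼-closed : ∀ {I : Subset n} {k} → PosInit n i I k → ∀ {x y} → Pos n x → I y → x ≼ y → I x
  posInit-≼-closed (_ , _ , closed) {x} {y} px iy x≼y with x ≟ᵥ y
  ... | yes refl = iy
  ... | no x≢y = closed x y px iy (≼⇒<b (insertAt-mono i x≼y ℕ.≤-refl) (x≢y ∘ insertAt-injective i))

  posInit-nested : ∀ {P Q : Subset n} {s t} → P ⊆ Pos n → Q ⊆ Pos n → Closed (Pos n) _≺_ P → Closed (Pos n) _≺_ Q →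
    Size P s → Size Q t → s ≤ t → P ⊆ Q
  posInit-nested = initial-nested (λ x y _ _ x≢y → <b-total (x≢y ∘ insertAt-injective i))

  S-balInit-closed : ∀ {I : Subset n} {k} → BalInit n I k → Closed (Pos n) _≺_ (S n I)
  S-balInit-closed (_ , _ , closed) x y px (py , yₖ∈I) x≺y =
    px , S-balClosed closed py yₖ∈I (witness-insertAt i 0 (<b⇒witness x≺y))

size-∩-≥ : ∀ {n} {P Q : Subset n} {s t w v} → (s ≤ t → P ⊆ Q) → (t ≤ s → Q ⊆ P) →
  Size P s → Size Q t → Size (P ∩ Q) w → v ≤ s → v ≤ t → v ≤ w
size-∩-≥ {s = s} {t} {v = v} P⊆Q Q⊆P sP sQ sPQ v≤s v≤t with ℕ.≤-total s t
... | inj₁ s≤t = subst (v ≤_) (size-unique (size-ext (λ x px → px , P⊆Q s≤t x px) (λ _ → proj₁) sP) sPQ) v≤s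
... | inj₂ t≤s = subst (v ≤_) (size-unique (size-ext (λ x qx → Q⊆P t≤s x qx , qx) (λ _ → proj₂) sQ) sPQ) v≤t

-- Slices along a coordinate

module _ {n : ℕ} (i : Fin (suc n)) {A : Subset (suc n)} where

  L-finite : ∀ {s} → Size A s → ∀ a → ∃ (Size (L n i a A))
  L-finite sA a = finite-via-section (λ u → insertAt u i a) (λ x → removeAt x i) (λ u → removeAt-insertAt u i a)
    (λ u → X? u ×-dec sumOver-dec (size⇒sumOver sA) (insertAt u i a)) (λ _ → proj₂) sA

  K-finite : ∀ {s} → Size A s → ∃ (Size (K n i A))
  K-finite sA = finite-via-section (λ u → insertAt u i 0) (λ x → removeAt x i) (λ u → removeAt-insertAt u i 0)
    (λ u → Pos? u ×-dec sumOver-dec (size⇒sumOver sA) (insertAt u i 0)) (λ _ → proj₂) sA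

  module _ (dA : DownSet (suc n) A) where

    L-downSet : ∀ a → DownSet n (L n i a A)
    L-downSet a = (λ _ → proj₁) , λ x y (y∈X , y∈A) x≤y →
      let x≼y = pointwise {x = x} {y} x≤y in X-≼ x≼y y∈X , proj₂ dA _ _ y∈A (≤-at (insertAt-mono i x≼y ℕ.≤-refl))

    L-antitone : ∀ {a b} → a ≤ b → L n i b A ⊆ L n i a A
    L-antitone a≤b u (u∈X , u∈A) = u∈X , proj₂ dA _ _ u∈A (≤-at (insertAt-mono i (≼-refl {x = u}) a≤b))

    K⊆S-L₀ : K n i A ⊆ S n (L n i 0 A)
    K⊆S-L₀ u (pos , u∈A) = pos , λ k → X-≔0 u k , proj₂ dA _ _ u∈A (≤-at (insertAt-mono i (≔0-≼ u k) ℕ.≤-refl))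

-- A point x of S(D) is recovered from x[1]≔0 and x[0]≔0, both in D; this needs two coordinates.
S-finite : ∀ {m} {D : Subset (suc (suc m))} {s} → Size D s → ∃ (Size (S (suc (suc m)) D))
S-finite {m} {D} sD@(l , _ , mem , _) =
  let (t , sS) = sumOver-cover S? (cartesianProductWith glue l l) covered (λ _ → 1) in t , sumOver⇒size sS
  where
  f₁ : Fin (suc (suc m))
  f₁ = fsuc fzero
  glue : Pt (suc (suc m)) → Pt (suc (suc m)) → Pt (suc (suc m))
  glue d e = d [ f₁ ]≔ lookup e f₁
  glue-≔0 : ∀ x → glue (x [ f₁ ]≔ 0) (x [ fzero ]≔ 0) ≡ x
  glue-≔0 x = vec-ext λ l → restored l (l Fin.≟ f₁)
    where
    restored : ∀ l → Dec (l ≡ f₁) → lookup (glue (x [ f₁ ]≔ 0) (x [ fzero ]≔ 0)) l ≡ lookup x l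
    restored l (yes refl) = trans (lookup∘update f₁ (x [ f₁ ]≔ 0) _) (lookup∘update′ (λ ()) x 0)
    restored l (no l≢f₁) = trans (lookup∘update′ l≢f₁ (x [ f₁ ]≔ 0) _) (lookup∘update′ l≢f₁ x 0)
  S? : ∀ x → Dec (S (suc (suc m)) D x)
  S? x = Pos? x ×-dec Fin.all? (λ k → sumOver-dec (size⇒sumOver sD) (x [ k ]≔ 0))
  covered : ∀ x → S (suc (suc m)) D x → x ∈ cartesianProductWith glue l l
  covered x (_ , x≔0∈D) = subst (_∈ cartesianProductWith glue l l) (glue-≔0 x)
    (∈-cartesianProductWith⁺ glue (Equivalence.from (mem _) (x≔0∈D f₁)) (Equivalence.from (mem _) (x≔0∈D fzero)))

-- Projections and heights

ZeroAt : ∀ {n} → Fin n → Subset n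
ZeroAt k x = lookup x k ≡ 0

module _ {n : ℕ} {D : Subset (suc n)} where

  sumOver-isZero : ∀ {s v} k → Size D s → Size (D ∩ ZeroAt k) v → SumOver D (λ x → isZero (lookup x k)) v
  sumOver-isZero k sD sZ =
    let (w , sw) = sumOver-exists (size⇒sumOver sD) (λ x → isZero (lookup x k))
        (w₁ , sw₁) = sumOver-restrict (λ x → lookup x k ≟ 0) sw
        (w₂ , sw₂) = sumOver-restrict (λ x → ¬? (lookup x k ≟ 0)) sw
        w₁≡v = sumOver-unique (sumOver-cong (λ x (_ , xₖ≡0) → cong isZero xₖ≡0) sw₁) (size⇒sumOver sZ)
        w₂≡0 = sumOver-zero (λ x (_ , xₖ≢0) → isZero-≢0 xₖ≢0) sw₂
    in subst (SumOver D _)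
         (trans (sumOver-split (λ x → lookup x k ≟ 0) sw sw₁ sw₂) (trans (cong₂ _+_ w₁≡v w₂≡0) (ℕ.+-identityʳ _))) sw
    where
    isZero-≢0 : ∀ {a} → a ≢ 0 → isZero a ≡ 0
    isZero-≢0 {zero} a≢0 = ⊥-elim (a≢0 refl)
    isZero-≢0 {suc a} _ = refl

  proj-size : DownSet (suc n) D → ∀ k {v} → Size (D ∩ ZeroAt k) v → Size (proj n k D) v
  proj-size dD k sZ = sumOver⇒size (sumOver-image (λ x → removeAt x k) (λ x (dx , _) → x , dx , refl)
    (λ x y (_ , xₖ≡0) (_ , yₖ≡0) rx≡ry → removeAt-injective k rx≡ry (trans xₖ≡0 (sym yₖ≡0)))
    onto (size⇒sumOver sZ))
    where
    onto : ∀ u → proj n k D u → ∃ λ x → (D ∩ ZeroAt k) x × removeAt x k ≡ u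
    onto u (x , dx , refl) = insertAt (removeAt x k) k 0 ,
      (subst D (sym (insertAt-removeAt-≔ k x 0)) (proj₂ dD _ _ dx (≤-at (≔0-≼ x k))) , insertAt-lookup _ k 0) ,
      removeAt-insertAt _ k 0

  Σ-proj≡Σ-zeros : ∀ {s} → DownSet (suc n) D → Size D s → (p : Fin (suc n) → ℕ) →
    (∀ k → Size (proj n k D) (p k)) → SumOver D zeros (Vec.sum (tabulate p))
  Σ-proj≡Σ-zeros dD sD p sp = sumOver-Σ sD (λ k x → isZero (lookup x k)) p λ k →
    let (v , sZ) = sumOver-restrict (λ x → lookup x k ≟ 0) (size⇒sumOver sD) in
    subst (SumOver D _) (size-unique (proj-size dD k (sumOver⇒size sZ)) (sp k)) (sumOver-isZero k sD (sumOver⇒size sZ))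

  proj-finite : ∀ {s} → DownSet (suc n) D → Size D s → ∀ k → ∃ (Size (proj n k D))
  proj-finite dD sD k =
    let (v , sZ) = sumOver-restrict (λ x → lookup x k ≟ 0) (size⇒sumOver sD) in v , proj-size dD k (sumOver⇒size sZ)

module _ {n : ℕ} (i : Fin (suc n)) where

  Coord : Pt (suc n) → ℕ
  Coord x = lookup x i

  private
    ins : ℕ → Pt n → Pt (suc n)
    ins a u = insertAt u i a

    restore : ∀ x {a} → Coord x ≡ a → ins a (removeAt x i) ≡ x
    restore x refl = insertAt-removeAt x i

    ins-injective : ∀ {P : Subset (suc n)} {a} x y → Level Coord P a x → Level Coord P a y →
      removeAt x i ≡ removeAt y i → x ≡ y
    ins-injective _ _ (_ , xᵢ≡a) (_ , yᵢ≡a) rx≡ry = removeAt-injective i rx≡ry (trans xᵢ≡a (sym yᵢ≡a))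

    ReducedX : Subset (suc n)
    ReducedX x = X n (removeAt x i)

  module _ {Z : Subset (suc n)} {f : Pt (suc n) → ℕ} where

    level-L : ∀ {a v} → SumOver (Level Coord Z a ∩ ReducedX) f v → SumOver (L n i a Z) (f ∘ ins a) v
    level-L {a} s = sumOver-image (λ x → removeAt x i)
      (λ x ((zx , xᵢ≡a) , rx∈X) → rx∈X , subst Z (sym (restore x xᵢ≡a)) zx)
      (λ x y (lx , _) (ly , _) → ins-injective x y lx ly)
      (λ u (u∈X , zu) → ins a u , ((zu , insertAt-lookup u i a) , subst (X n) (sym (removeAt-insertAt u i a)) u∈X) ,
                         removeAt-insertAt u i a)
      (sumOver-cong (λ x ((_ , xᵢ≡a) , _) → cong f (sym (restore x xᵢ≡a))) s)

    level-K : ∀ {v} → SumOver (Level Coord Z 0 ∩ ∁ ReducedX) f v → SumOver (K n i Z) (f ∘ ins 0) v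
    level-K s = sumOver-image (λ x → removeAt x i)
      (λ x ((zx , xᵢ≡0) , rx∉X) → ¬X⇒Pos (removeAt x i) rx∉X , subst Z (sym (restore x xᵢ≡0)) zx)
      (λ x y (lx , _) (ly , _) → ins-injective x y lx ly)
      (λ u (pos , zu) → ins 0 u ,
         ((zu , insertAt-lookup u i 0) , Pos⇒¬X (removeAt (ins 0 u) i) (subst (Pos n) (sym (removeAt-insertAt u i 0)) pos)) ,
                         removeAt-insertAt u i 0)
      (sumOver-cong (λ x ((_ , xᵢ≡0) , _) → cong f (sym (restore x xᵢ≡0))) s)

    level-sum-≢0 : ∀ {a v} → Z ⊆ X (suc n) → a ≢ 0 → SumOver (Level Coord Z a) f v → SumOver (L n i a Z) (f ∘ ins a) v
    level-sum-≢0 Z⊆X a≢0 s = level-L (sumOver-ext (λ x lx → lx , reduced x lx) (λ _ → proj₁) s)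
      where
      reduced : ∀ x → Level Coord Z _ x → ReducedX x
      reduced x (zx , xᵢ≡a) with X? (removeAt x i)
      ... | yes rx∈X = rx∈X
      ... | no rx∉X = ⊥-elim (a≢0 (trans (sym xᵢ≡a) (X-¬X-removeAt i x (Z⊆X x zx) rx∉X)))

    level-sum-0 : ∀ {v v₁ v₂} → SumOver (Level Coord Z 0) f v →
      SumOver (L n i 0 Z) (f ∘ ins 0) v₁ → SumOver (K n i Z) (f ∘ ins 0) v₂ → v ≡ v₁ + v₂
    level-sum-0 s sL sK =
      let (_ , s₁) = sumOver-restrict (X? ∘ λ x → removeAt x i) s
          (_ , s₂) = sumOver-restrict (λ x → ¬? (X? (removeAt x i))) s
      in trans (sumOver-split (X? ∘ λ x → removeAt x i) s s₁ s₂)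
               (cong₂ _+_ (sumOver-unique (level-L s₁) sL) (sumOver-unique (level-K s₂) sK))

  module _ {Z : Subset (suc n)} where

    S-level : ∀ {a v} → 0 < a → Size (Level Coord (S (suc n) Z) a) v → Size (K n i Z ∩ S n (L n i a Z)) v
    S-level {a} 0<a s = sumOver⇒size (sumOver-image (λ x → removeAt x i) into
      (λ x y lx ly → ins-injective x y lx ly) onto (size⇒sumOver s))
      where
      into : ∀ x → Level Coord (S (suc n) Z) a x → (K n i Z ∩ S n (L n i a Z)) (removeAt x i)
      into x ((pos , x≔0∈Z) , xᵢ≡a) =
        (Pos-removeAt i x pos , subst Z (sym (insertAt-removeAt-≔ i x 0)) (x≔0∈Z i)) ,
        (Pos-removeAt i x pos , λ k → X-≔0 (removeAt x i) k ,
           subst Z (sym (trans (insertAt-≔ i (removeAt x i) k 0 a) (cong (_[ punchIn i k ]≔ 0) (restore x xᵢ≡a))))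
             (x≔0∈Z (punchIn i k)))
      onto : ∀ u → (K n i Z ∩ S n (L n i a Z)) u → ∃ λ x → Level Coord (S (suc n) Z) a x × removeAt x i ≡ u
      onto u ((pos , u₀∈Z) , (_ , uₖ∈L)) =
        ins a u , ((Pos-insertAt i u pos 0<a , punchIn-cases i at-i at-punchIn) , insertAt-lookup u i a) , removeAt-insertAt u i a
        where
        at-i : Z (ins a u [ i ]≔ 0)
        at-i = subst Z (trans (cong (ins 0) (sym (removeAt-insertAt u i a))) (insertAt-removeAt-≔ i (ins a u) 0)) u₀∈Z
        at-punchIn : ∀ l → Z (ins a u [ punchIn i l ]≔ 0)
        at-punchIn l = subst Z (insertAt-≔ i u l 0 a) (proj₂ (uₖ∈L l))

    S-level-0 : ∀ {v} → Size (Level Coord (S (suc n) Z) 0) v → v ≡ 0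
    S-level-0 s = sumOver-zero (λ x ((pos , _) , xᵢ≡0) → ⊥-elim (ℕ.<⇒≢ (pos i) (sym xᵢ≡0))) (size⇒sumOver s)

  module _ (Z : Subset (suc n)) where

    L-zeros : ∀ a {s w} → Size (L n i a Z) s → SumOver (L n i a Z) zeros w →
      SumOver (L n i a Z) (λ u → zeros (insertAt u i a)) (isZero a * s + w)
    L-zeros a sL sw = sumOver-cong (λ u _ → sym (zeros-insertAt u i a)) (sumOver-+ (sumOver-const (isZero a) sL) sw)

    K-zeros : ∀ {s} → Size (K n i Z) s → SumOver (K n i Z) (λ u → zeros (insertAt u i 0)) s
    K-zeros sK = sumOver-cong (λ u (pos , _) → sym (trans (zeros-insertAt u i 0) (cong suc (zeros-Pos u pos)))) (size⇒sumOver sK)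


-- The balanced compression

module Compression {m : ℕ} (shyp : SHyp (suc (suc m))) (i : Fin (suc (suc (suc m))))
  {A A' : Subset (suc (suc (suc m)))} (dA : DownSet (suc (suc (suc m))) A) {s : ℕ} (sA : Size A s)
  (comp : IsBalCompression (suc (suc m)) i A A') where

  private
    N : ℕ
    N = suc (suc m)

    ℓ : ℕ → ℕ
    ℓ a = proj₁ (L-finite i sA a)

    sL : ∀ a → Size (L N i a A) (ℓ a)
    sL a = proj₂ (L-finite i sA a)

    L'-init : ∀ a → BalInit N (L N i a A') (ℓ a)
    L'-init a = proj₁ (proj₂ comp) a (ℓ a) (sL a)

    sL' : ∀ a → Size (L N i a A') (ℓ a)
    sL' a = proj₁ (proj₂ (L'-init a))

    κ : ℕ
    κ = proj₁ (K-finite i sA)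

    sK : Size (K N i A) κ
    sK = proj₂ (K-finite i sA)

    K'-init : PosInit N i (K N i A') κ
    K'-init = proj₂ (proj₂ comp) κ sK

    sK' : Size (K N i A') κ
    sK' = proj₁ (proj₂ K'-init)

    A'⊆X : A' ⊆ X (suc N)
    A'⊆X = proj₁ comp

  S-L-≤ : ∀ a {σ σ'} → Size (S N (L N i a A)) σ → Size (S N (L N i a A')) σ' → σ ≤ σ'
  S-L-≤ a = shyp (L N i a A) (L-downSet i dA a) (ℓ a) (sL a) (L N i a A') (L'-init a) _ _

  K'-S-L'-nested : ∀ a {σ'} → Size (S N (L N i a A')) σ' →
    (κ ≤ σ' → K N i A' ⊆ S N (L N i a A')) × (σ' ≤ κ → S N (L N i a A') ⊆ K N i A')
  K'-S-L'-nested a sS' =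
    posInit-nested i (proj₁ K'-init) (λ _ → proj₁) (proj₂ (proj₂ K'-init)) (S-balInit-closed i (L'-init a)) sK' sS' ,
    posInit-nested i (λ _ → proj₁) (proj₁ K'-init) (S-balInit-closed i (L'-init a)) (proj₂ (proj₂ K'-init)) sS' sK'

  -- Both are initial segments of ≺, and |K(A')| = |K(A)| ≤ |S(L₀(A))| ≤ |S(L₀(A'))|.
  K'⊆S-L'₀ : K N i A' ⊆ S N (L N i 0 A')
  K'⊆S-L'₀ =
    let (σ , sS) = S-finite (sL 0) ; (σ' , sS') = S-finite (sL' 0) in
    proj₁ (K'-S-L'-nested 0 sS') (ℕ.≤-trans (size-mono (K⊆S-L₀ i dA) sK sS) (S-L-≤ 0 sS sS'))

  A'-≼-closed-L : ∀ {x y} → A' y → X N (removeAt y i) → x ≼ y → A' x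
  A'-≼-closed-L {x} {y} y∈A' ry∈X x≼y =
    subst A' (insertAt-removeAt x i) (proj₂ (balInit-≼-closed (L'-init (lookup x i)) ry∈L'ₓ (removeAt-mono i x≼y)))
    where
    ry∈L'ₓ : L N i (lookup x i) A' (removeAt y i)
    ry∈L'ₓ = balInit-nested (L'-init (lookup y i)) (L'-init (lookup x i))
      (size-mono (L-antitone i dA (≤-at x≼y i)) (sL _) (sL _)) _ (ry∈X , subst A' (sym (insertAt-removeAt y i)) y∈A')

  A'-≼-closed-K : ∀ {x y} → A' y → ¬ X N (removeAt y i) → x ≼ y → A' x
  A'-≼-closed-K {x} {y} y∈A' ry∉X x≼y = subst A' restored (below (X? (removeAt x i)))
    where
    yᵢ≡0 : lookup y i ≡ 0
    yᵢ≡0 = X-¬X-removeAt i y (A'⊆X y y∈A') ry∉X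
    restored : insertAt (removeAt x i) i 0 ≡ x
    restored = trans (cong (insertAt _ i) (sym (ℕ.n≤0⇒n≡0 (subst (_ ≤_) yᵢ≡0 (≤-at x≼y i))))) (insertAt-removeAt x i)
    ry∈K' : K N i A' (removeAt y i)
    ry∈K' = ¬X⇒Pos (removeAt y i) ry∉X , subst A' (trans (sym (insertAt-removeAt y i)) (cong (insertAt _ i) yᵢ≡0)) y∈A'
    below : Dec (X N (removeAt x i)) → A' (insertAt (removeAt x i) i 0)
    below (no rx∉X) = proj₂ (posInit-≼-closed i K'-init (¬X⇒Pos (removeAt x i) rx∉X) ry∈K' (removeAt-mono i x≼y))
    below (yes (k , rxₖ≡0)) =
      proj₂ (balInit-≼-closed (L'-init 0) (proj₂ (K'⊆S-L'₀ _ ry∈K') k) (≼-≔0 k (removeAt-mono i x≼y) rxₖ≡0))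

  compression-downSet : DownSet (suc N) A'
  compression-downSet = A'⊆X , λ x y y∈A' x≤y → closed (pointwise {x = x} {y} x≤y) y∈A' (X? (removeAt y i))
    where
    closed : ∀ {x y} → x ≼ y → A' y → Dec (X N (removeAt y i)) → A' x
    closed x≼y y∈A' (yes ry∈X) = A'-≼-closed-L y∈A' ry∈X x≼y
    closed x≼y y∈A' (no ry∉X) = A'-≼-closed-K y∈A' ry∉X x≼y

  S-level-≤ : ∀ a {v w} → Size (Level (Coord i) (S (suc N) A) a) v → Size (Level (Coord i) (S (suc N) A') a) w → v ≤ w
  S-level-≤ zero sv _ = subst (_≤ _) (sym (S-level-0 i {Z = A} sv)) z≤n
  S-level-≤ (suc a) sv sw =
    let (σ , sS) = S-finite (sL (suc a)) ; (σ' , sS') = S-finite (sL' (suc a))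
        sKS = S-level i {Z = A} (s≤s z≤n) sv ; sKS' = S-level i {Z = A'} (s≤s z≤n) sw
        (K'⊆S , S⊆K') = K'-S-L'-nested (suc a) sS'
    in size-∩-≥ K'⊆S S⊆K' sK' sS' sKS' (size-mono (λ _ → proj₁) sKS sK)
         (ℕ.≤-trans (size-mono (λ _ → proj₂) sKS sS) (S-L-≤ (suc a) sS sS'))

  compression-S : SizeLe (S (suc N) A) (S (suc N) A')
  compression-S _ _ sS sS' =
    let (B , bound) = sumOver-bound (size⇒sumOver sS) (Coord i) in
    sumOver-levelwise-≤ (Coord i) B bound (λ a _ sv sw → S-level-≤ a (sumOver⇒size sv) (sumOver⇒size sw))
      (size⇒sumOver sS) (size⇒sumOver sS')

  level-size-≡ : ∀ a {v w} →
    SumOver (Level (Coord i) A a) (λ _ → 1) v → SumOver (Level (Coord i) A' a) (λ _ → 1) w → v ≡ w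
  level-size-≡ a sv sw with a ≟ 0
  ... | yes refl = trans (level-sum-0 i sv (size⇒sumOver (sL 0)) (size⇒sumOver sK))
                         (sym (level-sum-0 i sw (size⇒sumOver (sL' 0)) (size⇒sumOver sK')))
  ... | no a≢0 = trans (size-unique (sumOver⇒size (level-sum-≢0 i (proj₁ dA) a≢0 sv)) (sL a))
                       (size-unique (sL' a) (sumOver⇒size (level-sum-≢0 i A'⊆X a≢0 sw)))

  L-zeros-≤ : GapHyp (suc m) → ∀ a {v w} → SumOver (L N i a A') zeros v → SumOver (L N i a A) zeros w → v ≤ w
  L-zeros-≤ gap a sv sw =
    let dL = L-downSet i dA a ; dL' = L-downSet i compression-downSet a
        sπ = λ k → proj₂ (proj-finite dL (sL a) k) ; sπ' = λ k → proj₂ (proj-finite dL' (sL' a) k)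
        gap-≤ = gap (L N i a A) (λ _ → proj₁) (ℓ a) (sL a) (L N i a A') (L'-init a) _ _ (ℓ a) (ℓ a) sπ' sπ (sL' a) (sL a)
    in subst₂ _≤_ (sumOver-unique (Σ-proj≡Σ-zeros dL' (sL' a) _ sπ') sv) (sumOver-unique (Σ-proj≡Σ-zeros dL (sL a) _ sπ) sw)
         (ℕ.+-cancelʳ-≤ (ℓ a) _ _ gap-≤)

  level-zeros-≤ : GapHyp (suc m) → ∀ a {v w} →
    SumOver (Level (Coord i) A' a) zeros v → SumOver (Level (Coord i) A a) zeros w → v ≤ w
  level-zeros-≤ gap a sv sw with sumOver-exists (size⇒sumOver (sL' a)) zeros | sumOver-exists (size⇒sumOver (sL a)) zeros
  ... | (z' , sz') | (z , sz) with a ≟ 0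
  ...   | yes refl =
    subst₂ _≤_ (sym (level-sum-0 i sv (L-zeros i A' 0 (sL' 0) sz') (K-zeros i A' sK')))
               (sym (level-sum-0 i sw (L-zeros i A 0 (sL 0) sz) (K-zeros i A sK)))
      (ℕ.+-monoˡ-≤ κ (ℕ.+-monoʳ-≤ (isZero 0 * ℓ 0) (L-zeros-≤ gap 0 sz' sz)))
  ...   | no a≢0 =
    subst₂ _≤_ (sumOver-unique (L-zeros i A' a (sL' a) sz') (level-sum-≢0 i A'⊆X a≢0 sv))
               (sumOver-unique (L-zeros i A a (sL a) sz) (level-sum-≢0 i (proj₁ dA) a≢0 sw))
      (ℕ.+-monoʳ-≤ (isZero a * ℓ a) (L-zeros-≤ gap a sz' sz))

  compression-gap : GapHyp (suc m) → GapLe N A' A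
  compression-gap gap p q a b sp sq sA' sA =
    let (B' , bound') = sumOver-bound (size⇒sumOver sA') (Coord i)
        (B , bound) = sumOver-bound (size⇒sumOver sA) (Coord i)
    in ℕ.+-mono-≤
         (sumOver-levelwise-≤ (Coord i) B' bound' (λ a _ → level-zeros-≤ gap a)
            (Σ-proj≡Σ-zeros compression-downSet sA' p sp) (Σ-proj≡Σ-zeros dA sA q sq))
         (sumOver-levelwise-≤ (Coord i) B bound (λ a _ sv sw → ℕ.≤-reflexive (level-size-≡ a sv sw))
            (size⇒sumOver sA) (size⇒sumOver sA'))

lemma10 : ∀ (m : ℕ) → SHyp (suc (suc m))
    → ∀ (A : Subset (suc (suc (suc m)))) → DownSet (suc (suc (suc m))) A → Finite A
    → ∀ (i : Fin (suc (suc (suc m)))) (A' : Subset (suc (suc (suc m))))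
    → IsBalCompression (suc (suc m)) i A A'
    → DownSet (suc (suc (suc m))) A'
      × SizeLe (S (suc (suc (suc m))) A) (S (suc (suc (suc m))) A')
      × (GapHyp (suc m) → GapLe (suc (suc m)) A' A)
lemma10 m shyp A dA (_ , sA) i A' comp = compression-downSet , compression-S , compression-gap
  where open Compression shyp i dA sA comp
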